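{- Let $\{a_n\}_{n\ge 0}$ and $\{c_n\}_{n\ge 0}$ be two sequences of complex numbers, and define $$b_n=\sum_{k=0}^n\binom{n}{k}a_k,\qquad d_n=\sum_{k=0}^n\binom{n}{k}(-1)^{n-k}c_k\quad(n\ge 0),$$ so that $c_n=\sum_{k=0}^n\binom{n}{k}d_k$. Then for every integer $n\ge 0$, $$\sum_{k=0}^n\binom{n}{k}a_kc_k=\sum_{m=0}^n\binom{n}{m}d_m\,\nabla^m b_n .$$
   Context: $\nabla$ denotes the backward difference operator acting on the sequence $\{b_n\}$: $\nabla b_n=b_n-b_{n-1}$, $\nabla^0 b_n=b_n$, and $\nabla^{m}b_n=\nabla(\nabla^{m-1}b_n)=\nabla^{m-1}b_n-\nabla^{m-1}b_{n-1}$. For $0\le m\le n$, $\nabla^m b_n$ only involves $b_{n-m},\dots,b_n$. -}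

module Defs where

open import Level using (Level)
open import Data.Nat using (ℕ; zero; suc; _∸_)
open import Data.Nat.Combinatorics using (_C_)
open import Algebra.Bundles using (CommutativeRing)

module Binomial {c ℓ : Level} (R : CommutativeRing c ℓ) where
  open CommutativeRing R

  fromℕ : ℕ → Carrier
  fromℕ zero    = 0#
  fromℕ (suc n) = 1# + fromℕ n

  sign : ℕ → Carrier
  sign zero    = 1#
  sign (suc k) = - (sign k)

  sumTo : ℕ → (ℕ → Carrier) → Carrier
  sumTo zero    f = f 0
  sumTo (suc n) f = sumTo n f + f (suc n)

  binom : ℕ → ℕ → Carrier
  binom n k = fromℕ (n C k)

  -- backward difference: ∇^0 b n = b n, ∇^(m+1) b n = ∇^m b n - ∇^m b (n-1)
  -- (only used with m ≤ n, where the truncated subtraction never bites)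
  nabla : ℕ → (ℕ → Carrier) → ℕ → Carrier
  nabla zero    b n = b n
  nabla (suc m) b n = nabla m b n - nabla m b (n ∸ 1)

  bSeq : (ℕ → Carrier) → ℕ → Carrier
  bSeq a n = sumTo n (λ k → binom n k * a k)

  dSeq : (ℕ → Carrier) → ℕ → Carrier
  dSeq cs n = sumTo n (λ k → binom n k * (sign (n ∸ k) * cs k))

-- Induction on n, for all pairs of sequences at once. Pascal's rule splits the
-- left side at n + 1 into the identity at n for (a, c) and for the shifted pair
-- (Ea, Ec), where (Ea)_k = a_{k+1}. On the right, d(Ec)_m = d_m + d_{m+1}, and
-- ∇^m b_n is the binomial transform of E^m a evaluated at n - m, which again
-- obeys Pascal's rule; the d_m-terms then recombine into the right side at
-- n + 1 by Pascal's rule once more.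
module Submission where

open import Defs
open import Data.Nat using (ℕ; zero; suc; _∸_; _≤_; _<_) renaming (_+_ to _+ℕ_)
open import Data.Nat.Properties using (≤-refl; m≤n⇒m≤1+n; +-suc; +-∸-assoc; m+[n∸m]≡n)
open import Data.Nat.Combinatorics using (_C_; nCk+nC[k+1]≡[n+1]C[k+1]; k>n⇒nCk≡0)
open import Function using (_∘_)
open import Algebra.Bundles using (CommutativeRing)
import Algebra.Properties.Ring as RingProperties
import Algebra.Properties.AbelianGroup as AbelianGroupProperties
import Algebra.Properties.CommutativeSemigroup as CommutativeSemigroupProperties
open import Relation.Binary.PropositionalEquality using (cong; subst)
import Relation.Binary.Reasoning.Setoid as SetoidReasoning

module BinomialTransform {c ℓ} (R : CommutativeRing c ℓ) where
  open CommutativeRing R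
  open Binomial R
  open RingProperties ring using (-‿distribˡ-*; -‿distribʳ-*)
  open AbelianGroupProperties +-abelianGroup using (⁻¹-∙-comm; xyx⁻¹≈y; \\-leftDividesˡ)
  open CommutativeSemigroupProperties +-commutativeSemigroup using () renaming (interchange to +-interchange)
  open SetoidReasoning setoid

  fromℕ-+ : ∀ m n → fromℕ (m +ℕ n) ≈ fromℕ m + fromℕ n
  fromℕ-+ zero    n = sym (+-identityˡ _)
  fromℕ-+ (suc m) n = trans (+-congˡ (fromℕ-+ m n)) (sym (+-assoc _ _ _))

  binom-n-0 : ∀ n → binom n 0 ≈ 1#
  binom-n-0 n = +-identityʳ 1#

  binom-suc-suc : ∀ n k → binom (suc n) (suc k) ≈ binom n k + binom n (suc k)
  binom-suc-suc n k = trans (sym (reflexive (cong fromℕ (nCk+nC[k+1]≡[n+1]C[k+1] n k))))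
                            (fromℕ-+ (n C k) (n C suc k))

  binom-> : ∀ {n k} → n < k → binom n k ≈ 0#
  binom-> n<k = reflexive (cong fromℕ (k>n⇒nCk≡0 n<k))

  sumTo-cong : ∀ n {f g : ℕ → Carrier} → (∀ k → f k ≈ g k) → sumTo n f ≈ sumTo n g
  sumTo-cong zero    f≈g = f≈g 0
  sumTo-cong (suc n) f≈g = +-cong (sumTo-cong n f≈g) (f≈g (suc n))

  sumTo-cong-≤ : ∀ n {f g : ℕ → Carrier} → (∀ k → k ≤ n → f k ≈ g k) → sumTo n f ≈ sumTo n g
  sumTo-cong-≤ zero    f≈g = f≈g 0 ≤-refl
  sumTo-cong-≤ (suc n) f≈g =
    +-cong (sumTo-cong-≤ n (λ k k≤n → f≈g k (m≤n⇒m≤1+n k≤n))) (f≈g (suc n) ≤-refl)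

  sumTo-+ : ∀ n (f g : ℕ → Carrier) → sumTo n (λ k → f k + g k) ≈ sumTo n f + sumTo n g
  sumTo-+ zero    f g = refl
  sumTo-+ (suc n) f g = trans (+-congʳ (sumTo-+ n f g)) (+-interchange _ _ _ _)

  sumTo-neg : ∀ n (f : ℕ → Carrier) → sumTo n (λ k → - f k) ≈ - sumTo n f
  sumTo-neg zero    f = refl
  sumTo-neg (suc n) f = trans (+-congʳ (sumTo-neg n f)) (⁻¹-∙-comm _ _)

  sumTo-suc-head : ∀ n (f : ℕ → Carrier) → sumTo (suc n) f ≈ f 0 + sumTo n (f ∘ suc)
  sumTo-suc-head zero    f = refl
  sumTo-suc-head (suc n) f = trans (+-congʳ (sumTo-suc-head n f)) (+-assoc _ _ _)

  binomSum-head : ∀ N n (h : ℕ → Carrier) →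
    sumTo (suc n) (λ k → binom N k * h k) ≈ h 0 + sumTo n (λ k → binom N (suc k) * h (suc k))
  binomSum-head N n h =
    trans (sumTo-suc-head n _) (+-congʳ (trans (*-congʳ (binom-n-0 N)) (*-identityˡ (h 0))))

  bSeq-extend : ∀ (h : ℕ → Carrier) n → bSeq h n ≈ sumTo (suc n) (λ k → binom n k * h k)
  bSeq-extend h n = begin
    bSeq h n                                    ≈⟨ +-identityʳ _ ⟨
    bSeq h n + 0#                               ≈⟨ +-congˡ (zeroˡ (h (suc n))) ⟨
    bSeq h n + 0# * h (suc n)                   ≈⟨ +-congˡ (*-congʳ (binom-> {n} ≤-refl)) ⟨
    sumTo (suc n) (λ k → binom n k * h k)       ∎

  bSeq-suc : ∀ (h : ℕ → Carrier) n → bSeq h (suc n) ≈ bSeq h n + bSeq (h ∘ suc) n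
  bSeq-suc h n = begin
    bSeq h (suc n)
      ≈⟨ binomSum-head (suc n) n h ⟩
    h 0 + sumTo n (λ k → binom (suc n) (suc k) * h (suc k))
      ≈⟨ +-congˡ (sumTo-cong n (λ k → trans (*-congʳ (binom-suc-suc n k)) (distribʳ _ _ _))) ⟩
    h 0 + sumTo n (λ k → binom n k * h (suc k) + binom n (suc k) * h (suc k))
      ≈⟨ +-congˡ (trans (sumTo-+ n _ _) (+-comm _ _)) ⟩
    h 0 + (U + bSeq (h ∘ suc) n)
      ≈⟨ +-assoc _ _ _ ⟨
    (h 0 + U) + bSeq (h ∘ suc) n
      ≈⟨ +-congʳ (trans (bSeq-extend h n) (binomSum-head n n h)) ⟨
    bSeq h n + bSeq (h ∘ suc) n ∎
    where U = sumTo n (λ k → binom n (suc k) * h (suc k))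

  sign-suc-∸ : ∀ {m k} → k ≤ m → sign (suc m ∸ k) ≈ - sign (m ∸ k)
  sign-suc-∸ k≤m = reflexive (cong sign (+-∸-assoc 1 k≤m))

  dSeq-suc : ∀ (cs : ℕ → Carrier) m → dSeq cs (suc m) ≈ - dSeq cs m + dSeq (cs ∘ suc) m
  dSeq-suc cs m = trans (bSeq-suc (λ k → sign (suc m ∸ k) * cs k) m)
                        (+-congʳ (trans (sumTo-cong-≤ m negate) (sumTo-neg m _)))
    where
    negate : ∀ k → k ≤ m → binom m k * (sign (suc m ∸ k) * cs k)
                          ≈ - (binom m k * (sign (m ∸ k) * cs k))
    negate k k≤m = begin
      binom m k * (sign (suc m ∸ k) * cs k)  ≈⟨ *-congˡ (*-congʳ (sign-suc-∸ k≤m)) ⟩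
      binom m k * (- sign (m ∸ k) * cs k)    ≈⟨ *-congˡ (-‿distribˡ-* _ _) ⟨
      binom m k * - (sign (m ∸ k) * cs k)    ≈⟨ -‿distribʳ-* _ _ ⟨
      - (binom m k * (sign (m ∸ k) * cs k))  ∎

  dSeq-shift : ∀ (cs : ℕ → Carrier) m → dSeq (cs ∘ suc) m ≈ dSeq cs m + dSeq cs (suc m)
  dSeq-shift cs m = sym (trans (+-congˡ (dSeq-suc cs m)) (\\-leftDividesˡ _ _))

  shift : ℕ → (ℕ → Carrier) → ℕ → Carrier
  shift m a j = a (m +ℕ j)

  bSeq-shift-suc : ∀ a m p → bSeq (shift m a) (suc p) ≈ bSeq (shift m a) p + bSeq (shift (suc m) a) p
  bSeq-shift-suc a m p = trans (bSeq-suc (shift m a) p)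
    (+-congˡ (sumTo-cong p (λ j → *-congˡ (reflexive (cong a (+-suc m j))))))

  nabla-bSeq-+ : ∀ a m p → nabla m (bSeq a) (m +ℕ p) ≈ bSeq (shift m a) p
  nabla-bSeq-+ a zero    p = refl
  nabla-bSeq-+ a (suc m) p = begin
    nabla m (bSeq a) (suc (m +ℕ p)) - nabla m (bSeq a) (m +ℕ p)
      ≈⟨ +-cong (sym (reflexive (cong (nabla m (bSeq a)) (+-suc m p)))) (-‿cong (nabla-bSeq-+ a m p)) ⟩
    nabla m (bSeq a) (m +ℕ suc p) - bSeq (shift m a) p
      ≈⟨ +-congʳ (trans (nabla-bSeq-+ a m (suc p)) (bSeq-shift-suc a m p)) ⟩
    (bSeq (shift m a) p + bSeq (shift (suc m) a) p) - bSeq (shift m a) p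
      ≈⟨ xyx⁻¹≈y _ _ ⟩
    bSeq (shift (suc m) a) p ∎

  nabla-bSeq : ∀ a {m n} → m ≤ n → nabla m (bSeq a) n ≈ bSeq (shift m a) (n ∸ m)
  nabla-bSeq a {m} {n} m≤n =
    subst (λ x → nabla m (bSeq a) x ≈ bSeq (shift m a) (n ∸ m)) (m+[n∸m]≡n m≤n) (nabla-bSeq-+ a m (n ∸ m))

  bSeq-+ : ∀ (f g : ℕ → Carrier) n → bSeq (λ k → f k + g k) n ≈ bSeq f n + bSeq g n
  bSeq-+ f g n = trans (sumTo-cong n (λ k → distribˡ _ _ _)) (sumTo-+ n _ _)

  bSeq-* : ∀ n (a cs : ℕ → Carrier) →
    bSeq (λ k → a k * cs k) n ≈ bSeq (λ m → dSeq cs m * bSeq (shift m a) (n ∸ m)) n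
  bSeq-* zero a cs = *-congˡ (begin
    a 0 * cs 0                              ≈⟨ *-comm _ _ ⟩
    cs 0 * a 0                              ≈⟨ *-cong (sym d₀) (sym b₀) ⟩
    dSeq cs 0 * bSeq (shift 0 a) 0          ∎)
    where
    d₀ : dSeq cs 0 ≈ cs 0
    d₀ = trans (*-congʳ (binom-n-0 0)) (trans (*-identityˡ _) (*-identityˡ _))
    b₀ : bSeq (shift 0 a) 0 ≈ a 0
    b₀ = trans (*-congʳ (binom-n-0 0)) (*-identityˡ _)
  bSeq-* (suc n) a cs = begin
    bSeq (λ k → a k * cs k) (suc n)
      ≈⟨ bSeq-suc _ n ⟩
    bSeq (λ k → a k * cs k) n + bSeq (λ k → a (suc k) * cs (suc k)) n
      ≈⟨ +-cong (bSeq-* n a cs) (bSeq-* n (a ∘ suc) (cs ∘ suc)) ⟩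
    X + bSeq (λ m → dSeq (cs ∘ suc) m * B (suc m) (n ∸ m)) n
      ≈⟨ +-congˡ (trans (sumTo-cong n (λ m → *-congˡ (trans (*-congʳ (dSeq-shift cs m)) (distribʳ _ _ _))))
                        (bSeq-+ _ _ n)) ⟩
    X + (Y + bSeq (h ∘ suc) n)
      ≈⟨ +-assoc _ _ _ ⟨
    (X + Y) + bSeq (h ∘ suc) n
      ≈⟨ +-congʳ (trans (sumTo-cong-≤ n (λ m m≤n → *-congˡ (h-split m m≤n))) (bSeq-+ _ _ n)) ⟨
    bSeq h n + bSeq (h ∘ suc) n
      ≈⟨ bSeq-suc h n ⟨
    bSeq h (suc n) ∎
    where
    B : ℕ → ℕ → Carrier
    B m = bSeq (shift m a)
    h : ℕ → Carrier
    h m = dSeq cs m * B m (suc n ∸ m)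
    X Y : Carrier
    X = bSeq (λ m → dSeq cs m * B m (n ∸ m)) n
    Y = bSeq (λ m → dSeq cs m * B (suc m) (n ∸ m)) n
    h-split : ∀ m → m ≤ n → h m ≈ dSeq cs m * B m (n ∸ m) + dSeq cs m * B (suc m) (n ∸ m)
    h-split m m≤n = trans (*-congˡ (trans (reflexive (cong (B m) (+-∸-assoc 1 m≤n)))
                                          (bSeq-shift-suc a m (n ∸ m))))
                          (distribˡ _ _ _)

theorem1 : ∀ {c ℓ} (R : CommutativeRing c ℓ) → let open CommutativeRing R in let open Binomial R in
    (a cs : ℕ → Carrier) (n : ℕ) →
    sumTo n (λ k → binom n k * (a k * cs k))
      ≈ sumTo n (λ m → binom n m * (dSeq cs m * nabla m (bSeq a) n))
theorem1 R a cs n = trans (bSeq-* n a cs)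
                          (sumTo-cong-≤ n (λ m m≤n → *-congˡ (*-congˡ (sym (nabla-bSeq a m≤n)))))
  where
  open CommutativeRing R
  open BinomialTransform R
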